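{- Let $G$ be a nontrivial cyclic group of order $n$, let $S$ be the set of all generators of $G$, and let $\Gamma(G)$ be the generator graph of $G$. If $n-|S| = 1$, then $\dim(\Gamma(G)) = n-1$.
   Context: For a group $G$, the generator graph $\Gamma(G)$ is the simple undirected graph whose vertex set is the set of elements of $G$, in which two distinct elements $x,y$ are adjacent if and only if at least one of them generates $G$. For a connected graph $\Gamma$ and an ordered set $W=\{w_1,\dots,w_k\}\subseteq V(\Gamma)$, let $r(u\mid W) = (d_\Gamma(u,w_1),\dots,d_\Gamma(u,w_k))$ with $d_\Gamma$ the graph distance; $W$ is a resolving set if $r(u\mid W)\ne r(v\mid W)$ for all distinct $u,v$. The metric dimension $\dim(\Gamma)$ is the minimum cardinality of a resolving set. -}

module Defs where

open import Data.Nat using (ℕ; zero; suc; _≤_)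
open import Data.Integer using (ℤ; +_; -[1+_])
open import Data.Product using (Σ; ∃; _×_; _,_)
open import Data.Sum using (_⊎_)
open import Data.List using (List; length)
open import Data.List.Membership.Propositional using (_∈_)
open import Data.List.Relation.Unary.Unique.Propositional using (Unique)
open import Relation.Binary.PropositionalEquality using (_≡_; _≢_)
open import Function.Bundles using (_⇔_)

-- Group-theoretic notions, for a group on a type A with operations
-- (_∙_, ε, _⁻¹) (group laws are imposed in the statement via IsGroup _≡_).

module GroupDefs {A : Set} (_∙_ : A → A → A) (ε : A) (_⁻¹ : A → A) where

  powℕ : A → ℕ → A
  powℕ x zero    = ε
  powℕ x (suc k) = x ∙ powℕ x k

  powℤ : A → ℤ → A
  powℤ x (+ k)      = powℕ x k
  powℤ x -[1+ k ]   = (powℕ x (suc k)) ⁻¹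

  Generates : A → Set
  Generates x = ∀ y → ∃ λ (k : ℤ) → powℤ x k ≡ y

  IsCyclic : Set
  IsCyclic = ∃ λ g → Generates g

  GenAdj : A → A → Set
  GenAdj x y = x ≢ y × (Generates x ⊎ Generates y)

HasCard : {A : Set} → (A → Set) → ℕ → Set
HasCard {A} P k = Σ (List A) λ L → Unique L × (∀ x → (x ∈ L) ⇔ P x) × length L ≡ k

module GraphDefs {A : Set} (Adj : A → A → Set) where

  data Walk : A → A → ℕ → Set where
    here : ∀ {u} → Walk u u 0
    step : ∀ {u v w k} → Adj u v → Walk v w k → Walk u w (suc k)

  Dist : A → A → ℕ → Set
  Dist u v k = Walk u v k × (∀ m → Walk u v m → k ≤ m)

  SameDist : A → A → A → Set
  SameDist u v w = ∀ k → Dist u w k ⇔ Dist v w k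

  Resolving : List A → Set
  Resolving W = ∀ u v → (∀ w → w ∈ W → SameDist u v w) → u ≡ v

  MetricDim : ℕ → Set
  MetricDim d =
    (Σ (List A) λ W → Unique W × Resolving W × length W ≡ d) ×
    (∀ W → Unique W → Resolving W → d ≤ length W)

{-# OPTIONS --safe #-}
module Submission where

-- Only one element fails to generate, so every pair of distinct elements contains a
-- generator and Γ(G) is the complete graph Kₙ. In Kₙ distinct vertices are at distance 1, so a set of vertices
-- resolves exactly when it misses at most one vertex: the complement of a vertex
-- resolves, while two vertices outside W have the same distance to every w ∈ W.

open import Defs
open import Data.Nat using (ℕ; zero; suc; _≤_; _∸_; _+_; z≤n; s≤s)
open import Data.Nat.Properties using (≤-trans; m∸n≤m; ∸-monoˡ-≤; m∸n+n≡m; 1+n≰n; ≤-antisym; module ≤-Reasoning)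
open import Data.Fin as Fin using (Fin)
open import Data.Product using (_,_; proj₁; proj₂)
open import Data.Sum using (_⊎_; inj₁; inj₂)
open import Data.List using (List; _∷_; length; tabulate)
open import Data.List.Properties using (length-tabulate; length-removeAt′)
open import Data.List.Relation.Unary.All as All using (_∷_)
open import Data.List.Relation.Unary.AllPairs using ([]; _∷_)
open import Data.List.Relation.Unary.All.Properties using (─⁺; ¬Any⇒All¬)
open import Data.List.Relation.Unary.Any using (here; there; index; any?; satisfied)
open import Data.List.Membership.Propositional using (_∈_; _∉_; _─_; lose)
open import Data.List.Membership.Propositional.Properties using (∈-tabulate⁺)
open import Data.List.Relation.Binary.Subset.Propositional using (_⊆_)
open import Data.List.Relation.Unary.Unique.Propositional using (Unique)
import Data.List.Relation.Unary.Unique.Propositional.Properties as Unique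
open import Algebra.Structures using (IsGroup)
open import Relation.Binary.Definitions using (DecidableEquality)
open import Relation.Binary.PropositionalEquality
  using (_≡_; _≢_; refl; sym; trans; cong; subst; module ≡-Reasoning)
open import Relation.Nullary using (yes; no; contradiction; decidable-stable)
open import Relation.Nullary.Decidable using (via-injection)
open import Function using (_∘_)
open import Function.Bundles using (_⤖_; mk⇔; Equivalence; Bijection)
open import Function.Properties.Bijection using (sym-≡)
open import Function.Properties.Equivalence using () renaming (sym to ⇔-sym)

private
  variable
    A : Set
    x y z : A
    xs ys : List A

∈-─ : (p : x ∈ ys) → z ∈ ys → z ≢ x → z ∈ ys ─ p
∈-─ (here refl) (here refl) z≢x = contradiction refl z≢x
∈-─ (here refl) (there q)   _   = q
∈-─ (there p)   (here refl) _   = here refl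
∈-─ (there p)   (there q)   z≢x = there (∈-─ p q z≢x)

Unique-─ : (p : x ∈ xs) → Unique xs → Unique (xs ─ p)
Unique-─ (here _)  (_    ∷ xs!) = xs!
Unique-─ (there p) (x≢xs ∷ xs!) = ─⁺ p x≢xs ∷ Unique-─ p xs!

Unique-⊆⇒length≤ : Unique xs → xs ⊆ ys → length xs ≤ length ys
Unique-⊆⇒length≤ []           _ = z≤n
Unique-⊆⇒length≤ {xs = x ∷ xs} {ys} (x≢xs ∷ xs!) xs⊆ys = begin
  suc (length xs)           ≤⟨ s≤s (Unique-⊆⇒length≤ xs! xs⊆ys─x) ⟩
  suc (length (ys ─ x∈ys))  ≡⟨ sym (length-removeAt′ ys (index x∈ys)) ⟩
  length ys                 ∎
  where
  open ≤-Reasoning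
  x∈ys : x ∈ ys
  x∈ys = xs⊆ys (here refl)
  xs⊆ys─x : xs ⊆ ys ─ x∈ys
  xs⊆ys─x z∈xs = ∈-─ x∈ys (xs⊆ys (there z∈xs)) (All.lookup x≢xs z∈xs ∘ sym)

module FiniteType {n : ℕ} {A : Set} (enum : Fin n ⤖ A) where

  open Bijection enum using (to; injective; strictlySurjective)

  _≟_ : DecidableEquality A
  _≟_ = via-injection (Bijection.injection (sym-≡ enum)) Fin._≟_

  open import Data.List.Membership.DecPropositional _≟_ using (_∈?_; _∉?_)

  elements : List A
  elements = tabulate to

  ∈-elements : ∀ x → x ∈ elements
  ∈-elements x = let i , toi≡x = strictlySurjective x in subst (_∈ elements) toi≡x (∈-tabulate⁺ i)

  elements-unique : Unique elements
  elements-unique = Unique.tabulate⁺ injective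

  length-elements : length elements ≡ n
  length-elements = length-tabulate to

  Unique⇒length≤n : {xs : List A} → Unique xs → length xs ≤ n
  Unique⇒length≤n {xs} xs! = subst (length xs ≤_) length-elements
    (Unique-⊆⇒length≤ xs! (λ {x} _ → ∈-elements x))

  covering⇒n≤length : {xs : List A} → (∀ x → x ∈ xs) → n ≤ length xs
  covering⇒n≤length {xs} covers = subst (_≤ length xs) length-elements
    (Unique-⊆⇒length≤ elements-unique (λ {x} _ → covers x))

  elementsExcept : A → List A
  elementsExcept x = elements ─ ∈-elements x

  elementsExcept-unique : ∀ x → Unique (elementsExcept x)
  elementsExcept-unique x = Unique-─ (∈-elements x) elements-unique

  ∈-elementsExcept : {x y : A} → y ≢ x → y ∈ elementsExcept x
  ∈-elementsExcept {x} {y} y≢x = ∈-─ (∈-elements x) (∈-elements y) y≢x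

  length-elementsExcept : ∀ x → length (elementsExcept x) ≡ n ∸ 1
  length-elementsExcept x = begin
    suc (length (elementsExcept x)) ∸ 1 ≡⟨ cong (_∸ 1) (sym (length-removeAt′ elements (index (∈-elements x)))) ⟩
    length elements ∸ 1                 ≡⟨ cong (_∸ 1) length-elements ⟩
    n ∸ 1                               ∎
    where open ≡-Reasoning

  missesAtMostOne⇒n∸1≤length : {xs : List A} → (∀ {u v} → u ∉ xs → v ∉ xs → u ≡ v) → n ∸ 1 ≤ length xs
  missesAtMostOne⇒n∸1≤length {xs} missesOne with any? (_∉? xs) elements
  ... | no noneMissing = ≤-trans (m∸n≤m n 1) (covering⇒n≤length covers)
    where
    covers : ∀ x → x ∈ xs
    covers x = decidable-stable (x ∈? xs) (noneMissing ∘ lose (∈-elements x))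
  ... | yes someMissing = ∸-monoˡ-≤ 1 (covering⇒n≤length covers)
    where
    covers : ∀ x → x ∈ proj₁ (satisfied someMissing) ∷ xs
    covers x with x ∈? xs
    ... | yes x∈xs = there x∈xs
    ... | no  x∉xs = here (missesOne x∉xs (proj₂ (satisfied someMissing)))

  missesOne⇒P⊎P : {P : A → Set} {s : ℕ} → HasCard P s → n ∸ s ≡ 1 →
                  {x y : A} → x ≢ y → P x ⊎ P y
  missesOne⇒P⊎P {P} {s} (L , L! , ∈L⇔P , length-L) n∸s≡1 {x} {y} x≢y with x ∈? L | y ∈? L
  ... | yes x∈L | _       = inj₁ (Equivalence.to (∈L⇔P x) x∈L)
  ... | no _    | yes y∈L = inj₂ (Equivalence.to (∈L⇔P y) y∈L)
  ... | no x∉L  | no y∉L  = contradiction (subst (suc (suc s) ≤_) n≡1+s 2+s≤n) 1+n≰n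
    where
    s≤n : s ≤ n
    s≤n = subst (_≤ n) length-L (Unique⇒length≤n L!)
    n≡1+s : n ≡ suc s
    n≡1+s = trans (sym (m∸n+n≡m s≤n)) (cong (_+ s) n∸s≡1)
    2+s≤n : suc (suc s) ≤ n
    2+s≤n = subst (λ l → suc (suc l) ≤ n) length-L
      (Unique⇒length≤n ((x≢y ∷ ¬Any⇒All¬ L x∉L) ∷ ¬Any⇒All¬ L y∉L ∷ L!))

module _ {A : Set} {Adj : A → A → Set} where

  open GraphDefs Adj

  Dist-refl : ∀ u → Dist u u 0
  Dist-refl u = here , λ _ _ → z≤n

  Dist-functional : ∀ {u v k l} → Dist u v k → Dist u v l → k ≡ l
  Dist-functional (walkₖ , minₖ) (walkₗ , minₗ) = ≤-antisym (minₖ _ walkₗ) (minₗ _ walkₖ)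

  SameDist-self⇒≡ : ∀ {u v} → SameDist u v u → u ≡ v
  SameDist-self⇒≡ {u} same with Equivalence.to (same 0) (Dist-refl u)
  ... | here , _ = refl

module CompleteGraph {A : Set} {Adj : A → A → Set} (complete : ∀ {u v} → u ≢ v → Adj u v) where

  open GraphDefs Adj

  Dist-≢ : ∀ {u v} → u ≢ v → Dist u v 1
  Dist-≢ u≢v = step (complete u≢v) here , atLeastOne
    where
    atLeastOne : ∀ k → Walk _ _ k → 1 ≤ k
    atLeastOne zero    here = contradiction refl u≢v
    atLeastOne (suc k) _    = s≤s z≤n

  SameDist-≢ : ∀ {u v w} → u ≢ w → v ≢ w → SameDist u v w
  SameDist-≢ {u} {v} {w} u≢w v≢w k = mk⇔
    (λ d → subst (Dist v w) (Dist-functional (Dist-≢ u≢w) d) (Dist-≢ v≢w))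
    (λ d → subst (Dist u w) (Dist-functional (Dist-≢ v≢w) d) (Dist-≢ u≢w))

  Resolving-⊇complement : DecidableEquality A → ∀ {x W} → (∀ {u} → u ≢ x → u ∈ W) → Resolving W
  Resolving-⊇complement _≟_ {x} W⊇ u v same with u ≟ x | v ≟ x
  ... | yes refl | yes refl = refl
  ... | no u≢x   | _        = SameDist-self⇒≡ (same u (W⊇ u≢x))
  ... | _        | no v≢x   = sym (SameDist-self⇒≡ (λ k → ⇔-sym (same v (W⊇ v≢x) k)))

  Resolving⇒missesAtMostOne : ∀ {W} → Resolving W → ∀ {u v} → u ∉ W → v ∉ W → u ≡ v
  Resolving⇒missesAtMostOne resolves {u} {v} u∉W v∉W = resolves u v λ w w∈W →
    SameDist-≢ (λ { refl → u∉W w∈W }) (λ { refl → v∉W w∈W })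

lemma5p1 : (n : ℕ) (A : Set) (_∙_ : A → A → A) (ε : A) (_⁻¹ : A → A) →
           IsGroup _≡_ _∙_ ε _⁻¹ →
           (Fin n ⤖ A) →
           2 ≤ n →
           GroupDefs.IsCyclic _∙_ ε _⁻¹ →
           (s : ℕ) → HasCard (GroupDefs.Generates _∙_ ε _⁻¹) s →
           n ∸ s ≡ 1 →
           GraphDefs.MetricDim (GroupDefs.GenAdj _∙_ ε _⁻¹) (n ∸ 1)
lemma5p1 (suc _) A _∙_ ε _⁻¹ _ enum (s≤s _) _ _ generators n∸s≡1 =
  ( elementsExcept x₀
  , elementsExcept-unique x₀
  , Resolving-⊇complement _≟_ ∈-elementsExcept
  , length-elementsExcept x₀ )
  , λ W _ resolves → missesAtMostOne⇒n∸1≤length (Resolving⇒missesAtMostOne resolves)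
  where
  open GroupDefs _∙_ ε _⁻¹
  open FiniteType enum
  open CompleteGraph {Adj = GenAdj} (λ u≢v → u≢v , missesOne⇒P⊎P generators n∸s≡1 u≢v)

  x₀ : A
  x₀ = Bijection.to enum Fin.zero
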